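{- Let $(W,S)$ be a simply-laced triangle-free Coxeter system. If ${\boldsymbol{\alpha}}$ and ${\boldsymbol{\beta}}$ are two braid equivalent reduced expressions for $w\in W$ with $\ell(w)\ge3$, then for every $\llbracket i,i+2\rrbracket\in\operatorname{bs}({\boldsymbol{\alpha}})\cap\operatorname{bs}({\boldsymbol{\beta}})$ we have $\operatorname{supp}_{\llbracket i,i+2\rrbracket}({\boldsymbol{\alpha}})=\operatorname{supp}_{\llbracket i,i+2\rrbracket}({\boldsymbol{\beta}})$.
   Context: A Coxeter system $(W,S)$: finite $S$, $W=\langle S\mid (st)^{m(s,t)}=e\rangle$, $m(s,s)=1$, $m(s,t)\in\{2,3,\dots,\infty\}$ for $s\ne t$; simply laced: $m(s,t)\le3$ for all $s,t$; Coxeter graph $\Gamma$: vertex set $S$, edge $\{s,t\}$ iff $m(s,t)\ge3$; triangle free: $\Gamma$ has no three-cycles. $\ell(w)$ is the length of a reduced (minimal-length) expression for $w$. A braid move replaces a consecutive subword $sts$ by $tst$ with $m(s,t)=3$; two reduced expressions are braid equivalent if related by a finite sequence of braid moves. For ${\boldsymbol{\alpha}}=s_{x_1}\cdots s_{x_m}$, $\operatorname{supp}_{\llbracket i,j\rrbracket}({\boldsymbol{\alpha}})=\{s_{x_k}: i\le k\le j\}$, and $\llbracket i,i+2\rrbracket$ is a braid shadow of ${\boldsymbol{\alpha}}$ if $s_{x_i}=s_{x_{i+2}}$ and $m(s_{x_i},s_{x_{i+1}})=3$; $\operatorname{bs}({\boldsymbol{\alpha}})$ is the set of braid shadows of ${\boldsymbol{\alpha}}$.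 -}

module Defs where

open import Data.Nat using (ℕ; zero; suc; _≤_; _≥_)
open import Data.Fin using (Fin)
open import Data.Maybe using (Maybe; just; nothing)
open import Data.List using (List; []; _∷_; _++_; length; take; drop)
open import Data.List.Membership.Propositional using (_∈_)
open import Data.Product using (Σ; _×_; ∃; ∃-syntax; _,_)
open import Data.Sum using (_⊎_)
open import Function.Bundles using (_⇔_)
open import Relation.Nullary using (¬_)
open import Relation.Binary.PropositionalEquality using (_≡_; _≢_)
open import Relation.Binary.Construct.Closure.ReflexiveTransitive using (Star)

-- Coxeter matrix on the generating set S = Fin n.
-- m s t = nothing encodes m(s,t) = ∞; m s t = just k encodes m(s,t) = k.
record CoxeterMatrix (n : ℕ) : Set where
  field
    m        : Fin n → Fin n → Maybe ℕ
    diag     : ∀ s → m s s ≡ just 1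
    symm     : ∀ s t → m s t ≡ m t s
    offdiag  : ∀ s t → s ≢ t → (m s t ≡ nothing) ⊎ (∃[ k ] (m s t ≡ just k × 2 ≤ k))
open CoxeterMatrix public

module _ {n : ℕ} (M : CoxeterMatrix n) where

  Word : Set
  Word = List (Fin n)

  alt : Fin n → Fin n → ℕ → Word
  alt s t zero = []
  alt s t (suc k) = s ∷ t ∷ alt s t k

  -- The congruence on words defining W = ⟨ S ∣ (st)^{m(s,t)} = e ⟩
  -- (elements of W are words modulo this relation; inverses of generators
  -- are the generators themselves since m(s,s) = 1).
  data _≈W_ : Word → Word → Set where
    ≈refl  : ∀ {u} → u ≈W u
    ≈sym   : ∀ {u v} → u ≈W v → v ≈W u
    ≈trans : ∀ {u v w} → u ≈W v → v ≈W w → u ≈W w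
    ≈rel   : ∀ u v s t k → m M s t ≡ just k → (u ++ alt s t k ++ v) ≈W (u ++ v)

  IsReduced : Word → Set
  IsReduced α = ∀ β → β ≈W α → length α ≤ length β

  data BraidMove : Word → Word → Set where
    braid : ∀ u v s t → m M s t ≡ just 3 →
            BraidMove (u ++ s ∷ t ∷ s ∷ v) (u ++ t ∷ s ∷ t ∷ v)

  BraidEquiv : Word → Word → Set
  BraidEquiv = Star BraidMove

  -- ⟦i, i+2⟧ is a braid shadow of α (positions 0-based)
  IsBraidShadow : Word → ℕ → Set
  IsBraidShadow α i = ∃[ s ] ∃[ t ] ∃[ rest ] (drop i α ≡ s ∷ t ∷ s ∷ rest × m M s t ≡ just 3)

  -- supp_{⟦i,j⟧}(α) as a list of letters; compared as sets
  suppList : Word → ℕ → ℕ → Word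
  suppList α i j = take (suc j Data.Nat.∸ i) (drop i α)

  SameSupp : Word → Word → ℕ → ℕ → Set
  SameSupp α β i j = ∀ x → (x ∈ suppList α i j) ⇔ (x ∈ suppList β i j)

SimplyLaced : ∀ {n} → CoxeterMatrix n → Set
SimplyLaced M = ∀ s t → s ≢ t → (m M s t ≡ just 2) ⊎ (m M s t ≡ just 3)

TriangleFree : ∀ {n} → CoxeterMatrix n → Set
TriangleFree M = ∀ s t u → ¬ (m M s t ≡ just 3 × m M t u ≡ just 3 × m M u s ≡ just 3)

-- Follow a braid path from α and record every braid shadow a b a met at a position i as the
-- pair {a, b} at i.  The records stay coherent with the current word: a letter lies in at most
-- one pair recorded at i, records never sit at adjacent positions, the letter at i + 1 lies in
-- every pair recorded at i, and its partner can be braided back next to it on either side.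
-- Reducedness forbids factors a b a b (they equal b a), which keeps records apart;
-- triangle-freeness prevents a move from creating at i a shadow whose pair meets a recorded one
-- without being equal to it.  In the end the shadows of α and β are both recorded at i and the
-- middle letter of β lies in both pairs, so the pairs coincide.
module Submission where

open import Defs
open import Data.Nat using (ℕ; zero; suc; pred; _+_; _∸_; _≤_; _<_; _≥_; z≤n; s≤s)
open import Data.Nat.Properties
open import Data.Fin using (Fin)
open import Data.Maybe using (Maybe; just; nothing)
open import Data.Maybe.Properties using (just-injective)
open import Data.List using (List; []; _∷_; _++_; length; take; drop)
open import Data.List.Properties using (length-++; ++-assoc)
open import Data.List.Membership.Propositional using (_∈_)
open import Data.List.Relation.Unary.Any using (here; there)
open import Data.Product using (Σ; _×_; _,_; proj₁; proj₂)
open import Data.Empty using (⊥; ⊥-elim)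
open import Function using (id)
open import Function.Bundles using (_⇔_; mk⇔)
open import Data.Sum using (_⊎_; inj₁; inj₂) renaming (map to ⊎-map)
open import Relation.Binary.PropositionalEquality using (_≡_; refl; sym; trans; cong; cong₂; subst; subst₂)
open import Relation.Binary.Construct.Closure.ReflexiveTransitive using (ε; _◅_; _◅◅_)

infixl 9 _‼_

_‼_ : ∀ {A : Set} → List A → ℕ → Maybe A
[]       ‼ _     = nothing
(x ∷ xs) ‼ zero  = just x
(x ∷ xs) ‼ suc k = xs ‼ k

module _ {A : Set} where

  just-unique : ∀ {m : Maybe A} {a b} → m ≡ just a → m ≡ just b → a ≡ b
  just-unique p q = just-injective (trans (sym p) q)

  ‼-++ˡ : ∀ (u z : List A) {k} → k < length u → (u ++ z) ‼ k ≡ u ‼ k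
  ‼-++ˡ (x ∷ u) z {zero}  _         = refl
  ‼-++ˡ (x ∷ u) z {suc k} (s≤s k<u) = ‼-++ˡ u z k<u

  ‼-++ʳ : ∀ (u z : List A) j → (u ++ z) ‼ (j + length u) ≡ z ‼ j
  ‼-++ʳ []      z j = cong (z ‼_) (+-identityʳ j)
  ‼-++ʳ (x ∷ u) z j = trans (cong ((x ∷ u ++ z) ‼_) (+-suc j (length u))) (‼-++ʳ u z j)

  ‼-beyond : ∀ (v : List A) {k} → length v ≤ k → v ‼ k ≡ nothing
  ‼-beyond []      _           = refl
  ‼-beyond (x ∷ v) (s≤s v≤k) = ‼-beyond v v≤k

  ‼-drop : ∀ (xs : List A) i k → drop i xs ‼ k ≡ xs ‼ (k + i)
  ‼-drop xs       zero    k = cong (xs ‼_) (sym (+-identityʳ k))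
  ‼-drop []       (suc i) k = refl
  ‼-drop (x ∷ xs) (suc i) k = trans (‼-drop xs i k) (cong ((x ∷ xs) ‼_) (sym (+-suc k i)))

  ‼-split : ∀ (xs : List A) k {a} → xs ‼ k ≡ just a →
            Σ (List A) λ u → Σ (List A) λ y → xs ≡ u ++ a ∷ y × length u ≡ k
  ‼-split (x ∷ xs) zero    refl = [] , xs , refl , refl
  ‼-split (x ∷ xs) (suc k) h with ‼-split xs k h
  ... | u , y , refl , refl = x ∷ u , y , refl , refl

  ∈-aba⇒∈-bab : ∀ {x a b : A} → x ∈ a ∷ b ∷ a ∷ [] → x ∈ b ∷ a ∷ b ∷ []
  ∈-aba⇒∈-bab (here x≡a)               = there (here x≡a)
  ∈-aba⇒∈-bab (there (here x≡b))       = here x≡b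
  ∈-aba⇒∈-bab (there (there (here x≡a))) = there (here x≡a)

  length-++-< : ∀ (u : List A) {p q : List A} y → length q < length p →
                length (u ++ q ++ y) < length (u ++ p ++ y)
  length-++-< u {p} {q} y q<p
    rewrite length-++ u {q ++ y} | length-++ u {p ++ y} | length-++ q {y} | length-++ p {y} =
    +-monoʳ-< (length u) (+-monoˡ-< (length y) q<p)

data Placement : ℕ → ℕ → Set where
  r≫i   : ∀ i d → Placement i (4 + i + d)
  r=i+3 : ∀ i → Placement i (3 + i)
  r=i+2 : ∀ i → Placement i (2 + i)
  r=i+1 : ∀ i → Placement i (1 + i)
  r=i   : ∀ i → Placement i i
  i=r+1 : ∀ r → Placement (1 + r) r
  i=r+2 : ∀ r → Placement (2 + r) r
  i=r+3 : ∀ r → Placement (3 + r) r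
  i≫r   : ∀ r d → Placement (4 + r + d) r

placement : ∀ i r → Placement i r
placement zero          zero                         = r=i 0
placement zero          (suc zero)                   = r=i+1 0
placement zero          (suc (suc zero))             = r=i+2 0
placement zero          (suc (suc (suc zero)))       = r=i+3 0
placement zero          (suc (suc (suc (suc d))))    = r≫i 0 d
placement (suc zero)                   zero          = i=r+1 0
placement (suc (suc zero))             zero          = i=r+2 0
placement (suc (suc (suc zero)))       zero          = i=r+3 0
placement (suc (suc (suc (suc d))))    zero          = i≫r 0 d
placement (suc i)       (suc r)                      = shift (placement i r)
  where
  shift : ∀ {i r} → Placement i r → Placement (suc i) (suc r)
  shift (r≫i i d) = r≫i (suc i) d
  shift (r=i+3 i) = r=i+3 (suc i)
  shift (r=i+2 i) = r=i+2 (suc i)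
  shift (r=i+1 i) = r=i+1 (suc i)
  shift (r=i i)   = r=i (suc i)
  shift (i=r+1 r) = i=r+1 (suc r)
  shift (i=r+2 r) = i=r+2 (suc r)
  shift (i=r+3 r) = i=r+3 (suc r)
  shift (i≫r r d) = i≫r (suc r) d

module _ {n : ℕ} (M : CoxeterMatrix n) where

  private
    infix 4 _≈_
    _≈_ : Word M → Word M → Set
    _≈_ = _≈W_ M

  Edge : Fin n → Fin n → Set
  Edge a b = m M a b ≡ just 3

  Edge-sym : ∀ {a b} → Edge a b → Edge b a
  Edge-sym {a} {b} e = trans (symm M b a) e

  Edge-irrefl : ∀ {a} → Edge a a → ⊥
  Edge-irrefl {a} e with trans (sym (diag M a)) e
  ... | ()

  ≈W-delete : ∀ u p x s t k → m M s t ≡ just k → u ++ p ++ alt M s t k ++ x ≈ u ++ p ++ x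
  ≈W-delete u p x s t k h = subst₂ _≈_ (++-assoc u p _) (++-assoc u p x) (≈rel (u ++ p) x s t k h)

  ≈W-insert : ∀ u p x a → u ++ p ++ x ≈ u ++ p ++ a ∷ a ∷ x
  ≈W-insert u p x a = ≈sym (≈W-delete u p x a a 1 (diag M a))

  -- s t s ≈ s t s·t t ≈ s t s t·s s·t ≈ (s t)³·t s t ≈ t s t
  ≈W-braid : ∀ u x {s t} → Edge s t → u ++ s ∷ t ∷ s ∷ x ≈ u ++ t ∷ s ∷ t ∷ x
  ≈W-braid u x {s} {t} e =
    ≈trans (≈W-insert u (s ∷ t ∷ s ∷ []) x t)
    (≈trans (≈W-insert u (s ∷ t ∷ s ∷ t ∷ []) (t ∷ x) s)
    (≈trans (≈W-insert u (s ∷ t ∷ s ∷ t ∷ s ∷ []) (s ∷ t ∷ x) t)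
            (≈W-delete u [] (t ∷ s ∷ t ∷ x) s t 3 e)))

  -- a b a b ≈ a b a b·a a ≈ (a b)³·b a ≈ b a
  ≈W-abab : ∀ u x {a b} → Edge a b → u ++ a ∷ b ∷ a ∷ b ∷ x ≈ u ++ b ∷ a ∷ x
  ≈W-abab u x {a} {b} e =
    ≈trans (≈W-insert u (a ∷ b ∷ a ∷ b ∷ []) x a)
    (≈trans (≈W-insert u (a ∷ b ∷ a ∷ b ∷ a ∷ []) (a ∷ x) b)
            (≈W-delete u [] (b ∷ a ∷ x) a b 3 e))

  braidMove-≈W : ∀ {v w} → BraidMove M v w → w ≈ v
  braidMove-≈W (braid u x s t e) = ≈sym (≈W-braid u x e)

  braidMove-length : ∀ {v w} → BraidMove M v w → length w ≡ length v
  braidMove-length (braid u x s t e) = trans (length-++ u) (sym (length-++ u))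

  reduced-braidEquiv : ∀ {v w} → IsReduced M v → BraidEquiv M v w → IsReduced M w
  reduced-braidEquiv red ε = red
  reduced-braidEquiv red (_◅_ {j = u} mv p) = reduced-braidEquiv reduced-u p
    where
    reduced-u : IsReduced M u
    reduced-u β β≈u = subst (_≤ length β) (sym (braidMove-length mv))
                               (red β (≈trans β≈u (braidMove-≈W mv)))

  record Shadow (v : Word M) (i : ℕ) (a b : Fin n) : Set where
    constructor shadow
    field
      first  : v ‼ i ≡ just a
      second : v ‼ suc i ≡ just b
      third  : v ‼ suc (suc i) ≡ just a
      edge   : Edge a b

  isBraidShadow⇒Shadow : ∀ v i → IsBraidShadow M v i → Σ (Fin n) λ a → Σ (Fin n) λ b →
                         Shadow v i a b × Σ (Word M) λ rest → drop i v ≡ a ∷ b ∷ a ∷ rest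
  isBraidShadow⇒Shadow v i (a , b , rest , v≡ , e) =
    a , b , shadow (letter 0) (letter 1) (letter 2) e , rest , v≡
    where
    letter : ∀ k → v ‼ (k + i) ≡ (a ∷ b ∷ a ∷ rest) ‼ k
    letter k = trans (sym (‼-drop v i k)) (cong (_‼ k) v≡)

  reduced-noABAB : ∀ {v} → IsReduced M v → ∀ {k a b} → Shadow v k a b → v ‼ (3 + k) ≡ just b → ⊥
  reduced-noABAB {v} red {k} {a} {b} (shadow v₀ v₁ v₂ e) v₃ with ‼-split v k v₀
  ... | u , y , refl , refl
      with y | trans (sym (‼-++ʳ u (a ∷ y) 1)) v₁ | trans (sym (‼-++ʳ u (a ∷ y) 2)) v₂
             | trans (sym (‼-++ʳ u (a ∷ y) 3)) v₃
  ... | .b ∷ .a ∷ .b ∷ y′ | refl | refl | refl =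
    <⇒≱ (length-++-< u y′ (s≤s (s≤s (s≤s z≤n)))) (red (u ++ b ∷ a ∷ y′) (≈sym (≈W-abab u y′ e)))

  reduced-shadows-separated : ∀ {v} → IsReduced M v →
                              ∀ {i a b c d} → Shadow v i a b → Shadow v (suc i) c d → ⊥
  reduced-shadows-separated red sh sh′ =
    reduced-noABAB red sh (trans (Shadow.third sh′) (cong just (just-unique (Shadow.first sh′) (Shadow.second sh))))

  record MoveAt (v w : Word M) (r : ℕ) (s t : Fin n) : Set where
    field
      source : Shadow v r s t
      target : Shadow w r t s
      below  : ∀ k → k < r → w ‼ k ≡ v ‼ k
      above  : ∀ k → 3 + r ≤ k → w ‼ k ≡ v ‼ k

  moveAt : ∀ u x {s t} → Edge s t → MoveAt (u ++ s ∷ t ∷ s ∷ x) (u ++ t ∷ s ∷ t ∷ x) (length u) s t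
  moveAt u x {s} {t} e = record
    { source = shadow (‼-++ʳ u _ 0) (‼-++ʳ u _ 1) (‼-++ʳ u _ 2) e
    ; target = shadow (‼-++ʳ u _ 0) (‼-++ʳ u _ 1) (‼-++ʳ u _ 2) (Edge-sym e)
    ; below  = λ k k<u → trans (‼-++ˡ u _ k<u) (sym (‼-++ˡ u _ k<u))
    ; above  = above }
    where
    tail-agrees : ∀ {j} → 3 ≤ j → (t ∷ s ∷ t ∷ x) ‼ j ≡ (s ∷ t ∷ s ∷ x) ‼ j
    tail-agrees (s≤s (s≤s (s≤s _))) = refl

    above : ∀ k → 3 + length u ≤ k → (u ++ t ∷ s ∷ t ∷ x) ‼ k ≡ (u ++ s ∷ t ∷ s ∷ x) ‼ k
    above k 3+u≤k with k ∸ length u | m∸n+n≡m (m+n≤o⇒n≤o 3 3+u≤k) | m+n≤o⇒m≤o∸n 3 3+u≤k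
    ... | j | refl | 3≤j = trans (‼-++ʳ u _ j) (trans (tail-agrees 3≤j) (sym (‼-++ʳ u _ j)))

  braidMove⇒MoveAt : ∀ {v w} → BraidMove M v w →
                     Σ ℕ λ r → Σ (Fin n) λ s → Σ (Fin n) λ t → MoveAt v w r s t
  braidMove⇒MoveAt (braid u x s t e) = length u , s , t , moveAt u x e

  braidAt : ∀ {v k a b} → Shadow v k a b → Σ (Word M) λ w → BraidMove M v w × MoveAt v w k a b
  braidAt {v} {k} {a} {b} (shadow v₀ v₁ v₂ e) with ‼-split v k v₀
  ... | u , y , refl , refl with y | trans (sym (‼-++ʳ u (a ∷ y) 1)) v₁ | trans (sym (‼-++ʳ u (a ∷ y) 2)) v₂
  ... | .b ∷ .a ∷ y′ | refl | refl = u ++ b ∷ a ∷ b ∷ y′ , braid u y′ a b e , moveAt u y′ e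

  History : Set₁
  History = ℕ → Fin n → Fin n → Set

  data Unordered (H : History) (i : ℕ) (a b : Fin n) : Set where
    forward  : H i a b → Unordered H i a b
    backward : H i b a → Unordered H i a b

  infixr 5 _∪_
  data _∪_ (H G : History) (i : ℕ) (a b : Fin n) : Set where
    inˡ : H i a b → (H ∪ G) i a b
    inʳ : G i a b → (H ∪ G) i a b

  Unordered-sym : ∀ {H i a b} → Unordered H i a b → Unordered H i b a
  Unordered-sym (forward h)  = backward h
  Unordered-sym (backward h) = forward h

  Unordered-edge : ∀ {H} → (∀ {i a b} → H i a b → Edge a b) → ∀ {i a b} → Unordered H i a b → Edge a b
  Unordered-edge edges (forward h)  = edges h
  Unordered-edge edges (backward h) = Edge-sym (edges h)

  Unordered-inˡ : ∀ {H G i a b} → Unordered H i a b → Unordered (H ∪ G) i a b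
  Unordered-inˡ (forward h)  = forward (inˡ h)
  Unordered-inˡ (backward h) = backward (inˡ h)

  Unordered-∪ : ∀ {H G i a b} → Unordered (H ∪ G) i a b → Unordered H i a b ⊎ Unordered G i a b
  Unordered-∪ (forward (inˡ h))  = inj₁ (forward h)
  Unordered-∪ (forward (inʳ g))  = inj₂ (forward g)
  Unordered-∪ (backward (inˡ h)) = inj₁ (backward h)
  Unordered-∪ (backward (inʳ g)) = inj₂ (backward g)

  Shadow-unordered-functional : ∀ {v i a b c} →
    Unordered (Shadow v) i a b → Unordered (Shadow v) i a c → b ≡ c
  Shadow-unordered-functional (forward p) (forward q) = just-unique (Shadow.second p) (Shadow.second q)
  Shadow-unordered-functional (forward p) (backward q) =
    trans (just-unique (Shadow.second p) (Shadow.second q)) (just-unique (Shadow.first p) (Shadow.first q))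
  Shadow-unordered-functional (backward p) (forward q) =
    trans (just-unique (Shadow.first p) (Shadow.first q)) (just-unique (Shadow.second p) (Shadow.second q))
  Shadow-unordered-functional (backward p) (backward q) = just-unique (Shadow.first p) (Shadow.first q)

  -- e can be brought to position i by braid moves left of i + 1: either it is there, or e x sit at
  -- i - 1, i for a recorded pair {e, x} at i - 2, so that once x is brought to i - 2 the braid
  -- x e x ↦ e x e does it.
  data LeftReachable (v : Word M) (H : History) : ℕ → Fin n → Set where
    in-place : ∀ {i e} → v ‼ i ≡ just e → LeftReachable v H i e
    by-braid : ∀ {j e x} → v ‼ suc j ≡ just e → v ‼ (2 + j) ≡ just x → Unordered H j e x →
               LeftReachable v H (2 + j) e

  data RightReachable (v : Word M) (H : History) (i : ℕ) (e : Fin n) : Set where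
    in-place : v ‼ (2 + i) ≡ just e → RightReachable v H i e
    by-braid : ∀ {x} → v ‼ (3 + i) ≡ just e → v ‼ (2 + i) ≡ just x → Unordered H (2 + i) e x →
               RightReachable v H i e

  pullLeft : ∀ {v H} → (∀ {i a b} → H i a b → Edge a b) →
             (∀ {i c e} → Unordered H i c e → v ‼ suc i ≡ just c → LeftReachable v H i e) →
             ∀ i {e} → LeftReachable v H i e →
             Σ (Word M) λ v′ → BraidEquiv M v v′ × v′ ‼ i ≡ just e ×
                               (∀ k → i < k → v′ ‼ k ≡ v ‼ k)
  pullLeft edges left i (in-place vᵢ) = _ , ε , vᵢ , λ _ _ → refl
  pullLeft edges left (suc (suc j)) (by-braid v₁ v₂ pair)
    with pullLeft edges left j (left pair v₁)
  ... | u , v⇝u , uⱼ , agree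
    with braidAt (shadow uⱼ (trans (agree _ ≤-refl) v₁) (trans (agree _ (n≤1+n _)) v₂)
                         (Edge-sym (Unordered-edge edges pair)))
  ... | w , mv , mvAt =
    w , v⇝u ◅◅ (mv ◅ ε) , Shadow.third (MoveAt.target mvAt) ,
    λ k 2+j<k → trans (MoveAt.above mvAt k 2+j<k) (agree k (m+n≤o⇒n≤o 2 2+j<k))

  private
    pullRight-fuel : ∀ {v H} → (∀ {i a b} → H i a b → Edge a b) →
                     (∀ {i c e} → Unordered H i c e → v ‼ suc i ≡ just c → RightReachable v H i e) →
                     ∀ fuel i {e} → length v ≤ fuel + i → RightReachable v H i e →
                     Σ (Word M) λ v′ → BraidEquiv M v v′ × v′ ‼ (2 + i) ≡ just e ×
                                       (∀ k → k ≤ suc i → v′ ‼ k ≡ v ‼ k)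
    pullRight-fuel edges right fuel i _ (in-place v₂) = _ , ε , v₂ , λ _ _ → refl
    pullRight-fuel {v} edges right zero i v≤i (by-braid v₃ _ _)
      with trans (sym v₃) (‼-beyond v (≤-trans v≤i (m≤n+m i 3)))
    ... | ()
    pullRight-fuel {v} edges right (suc f) i v≤ (by-braid v₃ v₂ pair)
      with pullRight-fuel edges right f (2 + i) v≤′ (right pair v₃)
      where
      v≤′ : length v ≤ f + (2 + i)
      v≤′ = ≤-trans v≤ (≤-trans (≤-reflexive (sym (+-suc f i))) (+-monoʳ-≤ f (n≤1+n (suc i))))
    ... | u , v⇝u , u₄ , agree
      with braidAt (shadow (trans (agree _ (n≤1+n _)) v₂) (trans (agree _ ≤-refl) v₃) u₄
                           (Edge-sym (Unordered-edge edges pair)))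
    ... | w , mv , mvAt =
      w , v⇝u ◅◅ (mv ◅ ε) , Shadow.first (MoveAt.target mvAt) ,
      λ k k≤1+i → trans (MoveAt.below mvAt k (s≤s k≤1+i)) (agree k (≤-trans k≤1+i (m≤n+m _ 2)))

  pullRight : ∀ {v H} → (∀ {i a b} → H i a b → Edge a b) →
              (∀ {i c e} → Unordered H i c e → v ‼ suc i ≡ just c → RightReachable v H i e) →
              ∀ i {e} → RightReachable v H i e →
              Σ (Word M) λ v′ → BraidEquiv M v v′ × v′ ‼ (2 + i) ≡ just e ×
                                (∀ k → k ≤ suc i → v′ ‼ k ≡ v ‼ k)
  pullRight {v} edges right i = pullRight-fuel edges right (length v) i (m≤m+n _ _)

  shadow-reachable : ∀ {v H i c e} → Unordered (Shadow v) i c e → v ‼ suc i ≡ just c →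
                     LeftReachable v H i e × RightReachable v H i e
  shadow-reachable (forward (shadow _ v₁ _ ce)) v₁′ with just-unique v₁ v₁′
  ... | refl = ⊥-elim (Edge-irrefl ce)
  shadow-reachable (backward (shadow v₀ _ v₂ _)) _ = in-place v₀ , in-place v₂

  leftReachable-transport : ∀ {v w H G i e} → LeftReachable v H i e →
    w ‼ i ≡ v ‼ i → w ‼ pred i ≡ v ‼ pred i → LeftReachable w (H ∪ G) i e
  leftReachable-transport (in-place vᵢ) wᵢ _ = in-place (trans wᵢ vᵢ)
  leftReachable-transport (by-braid v₁ v₂ pair) wᵢ w₁ =
    by-braid (trans w₁ v₁) (trans wᵢ v₂) (Unordered-inˡ pair)

  rightReachable-transport : ∀ {v w H G i e} → RightReachable v H i e →
    w ‼ (2 + i) ≡ v ‼ (2 + i) → w ‼ (3 + i) ≡ v ‼ (3 + i) → RightReachable w (H ∪ G) i e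
  rightReachable-transport (in-place v₂) w₂ _ = in-place (trans w₂ v₂)
  rightReachable-transport (by-braid v₃ v₂ pair) w₂ w₃ =
    by-braid (trans w₃ v₃) (trans w₂ v₂) (Unordered-inˡ pair)

  record Coherent (v : Word M) (H : History) : Set where
    field
      edges      : ∀ {i a b} → H i a b → Edge a b
      functional : ∀ {i a b c} → Unordered H i a b → Unordered H i a c → b ≡ c
      separated  : ∀ {i a b c d} → H i a b → H (suc i) c d → ⊥
      middle     : ∀ {i a b} → H i a b → v ‼ suc i ≡ just a ⊎ v ‼ suc i ≡ just b
      reachable  : ∀ {i c e} → Unordered H i c e → v ‼ suc i ≡ just c →
                   LeftReachable v H i e × RightReachable v H i e
      complete   : ∀ {i a b} → Shadow v i a b → H i a b

    separated-unordered : ∀ {i a b c d} → Unordered H i a b → Unordered H (suc i) c d → ⊥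
    separated-unordered (forward h)  (forward h′)  = separated h h′
    separated-unordered (forward h)  (backward h′) = separated h h′
    separated-unordered (backward h) (forward h′)  = separated h h′
    separated-unordered (backward h) (backward h′) = separated h h′

  coherent-shadows : ∀ {v} → IsReduced M v → Coherent v (Shadow v)
  coherent-shadows red = record
    { edges      = Shadow.edge
    ; functional = Shadow-unordered-functional
    ; separated  = reduced-shadows-separated red
    ; middle     = λ sh → inj₂ (Shadow.second sh)
    ; reachable  = shadow-reachable
    ; complete   = λ sh → sh }

  private
    <-+ : ∀ i k → i < suc k + i
    <-+ i k = s≤s (m≤n+m i k)

    far-below : ∀ i d j → j ≤ 3 → j + i < 4 + i + d
    far-below i d j j≤3 = s≤s (≤-trans (+-monoˡ-≤ i j≤3) (m≤m+n (3 + i) d))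

    far-above : ∀ r d j → 3 + r ≤ j + (3 + r + d)
    far-above r d j = ≤-trans (m≤m+n (3 + r) d) (m≤n+m _ j)

  module _ {v w : Word M} {H : History} (coh : Coherent v H) where
    open Coherent coh
    open MoveAt
    open Shadow

    middle-preserved : ∀ {r s t} → MoveAt v w r s t → ∀ {i a b} → H i a b →
                       w ‼ suc i ≡ just a ⊎ w ‼ suc i ≡ just b
    middle-preserved {r} mv {i} {a} {b} h = go (placement i r) mv h
      where
      agreeing : ∀ {k} → w ‼ k ≡ v ‼ k →
                 v ‼ k ≡ just a ⊎ v ‼ k ≡ just b → w ‼ k ≡ just a ⊎ w ‼ k ≡ just b
      agreeing wₖ = ⊎-map (trans wₖ) (trans wₖ)

      go : ∀ {i r s t} → Placement i r → MoveAt v w r s t → H i a b →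
           w ‼ suc i ≡ just a ⊎ w ‼ suc i ≡ just b
      go (r≫i i d) mv h = agreeing (below mv _ (far-below i d 1 (s≤s z≤n))) (middle h)
      go (r=i+3 i) mv h = agreeing (below mv _ (s≤s (<-+ i 1))) (middle h)
      go (r=i+2 i) mv h = agreeing (below mv _ ≤-refl) (middle h)
      go (r=i+1 i) mv h = ⊥-elim (separated h (complete (source mv)))
      go (r=i i)   mv h with middle h
      ... | inj₁ v₁ with just-unique (second (source mv)) v₁
      ...   | refl = inj₂ (trans (second (target mv))
                                 (cong just (functional (backward (complete (source mv))) (forward h))))
      go (r=i i)   mv h | inj₂ v₁ with just-unique (second (source mv)) v₁
      ...   | refl = inj₁ (trans (second (target mv))
                                 (cong just (functional (backward (complete (source mv))) (backward h))))
      go (i=r+1 r) mv h = ⊥-elim (separated (complete (source mv)) h)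
      go (i=r+2 r) mv h = agreeing (above mv _ ≤-refl) (middle h)
      go (i=r+3 r) mv h = agreeing (above mv _ (m≤n+m _ 1)) (middle h)
      go (i≫r r d) mv h = agreeing (above mv _ (far-above r d 2)) (middle h)

    rightReachable-before-move : ∀ {i s t e} → MoveAt v w (3 + i) s t →
                                 RightReachable v H i e → RightReachable w (H ∪ Shadow w) i e
    rightReachable-before-move mv (in-place v₂) = in-place (trans (below mv _ ≤-refl) v₂)
    rightReachable-before-move mv (by-braid _ _ pair) =
      ⊥-elim (separated-unordered pair (forward (complete (source mv))))

    rightReachable-at-move : ∀ {i s t e} → MoveAt v w (2 + i) s t →
                             RightReachable v H i e → RightReachable w (H ∪ Shadow w) i e
    rightReachable-at-move mv (in-place v₂) with just-unique (first (source mv)) v₂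
    ... | refl = by-braid (second (target mv)) (first (target mv)) (forward (inˡ (complete (source mv))))
    rightReachable-at-move mv (by-braid v₃ _ _) with just-unique (second (source mv)) v₃
    ... | refl = in-place (first (target mv))

    leftReachable-at-move : ∀ {r s t e} → MoveAt v w r s t →
                            LeftReachable v H (2 + r) e → LeftReachable w (H ∪ Shadow w) (2 + r) e
    leftReachable-at-move mv (in-place vᵢ) with just-unique (third (source mv)) vᵢ
    ... | refl = by-braid (second (target mv)) (third (target mv)) (forward (inˡ (complete (source mv))))
    leftReachable-at-move mv (by-braid v₁ _ _) with just-unique (second (source mv)) v₁
    ... | refl = in-place (third (target mv))

    leftReachable-after-move : ∀ {r s t e} → MoveAt v w r s t →
                               LeftReachable v H (3 + r) e → LeftReachable w (H ∪ Shadow w) (3 + r) e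
    leftReachable-after-move mv (in-place vᵢ) = in-place (trans (above mv _ ≤-refl) vᵢ)
    leftReachable-after-move mv (by-braid _ _ pair) =
      ⊥-elim (separated-unordered (forward (complete (source mv))) pair)

    reachable-preserved : ∀ {r s t} → MoveAt v w r s t →
                          ∀ {i c e} → Unordered H i c e → w ‼ suc i ≡ just c →
                          LeftReachable w (H ∪ Shadow w) i e × RightReachable w (H ∪ Shadow w) i e
    reachable-preserved {r} mv {i} {c} {e} pair wc = go (placement i r) mv pair wc
      where
      go : ∀ {i r s t} → Placement i r → MoveAt v w r s t → Unordered H i c e → w ‼ suc i ≡ just c →
           LeftReachable w (H ∪ Shadow w) i e × RightReachable w (H ∪ Shadow w) i e
      go (r≫i i d) mv pair wc =
        let L , R = reachable pair (trans (sym (below mv _ (far-below i d 1 (s≤s z≤n)))) wc) in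
        leftReachable-transport L (below mv _ (far-below i d 0 z≤n))
                                  (below mv _ (≤-<-trans pred[n]≤n (far-below i d 0 z≤n))) ,
        rightReachable-transport R (below mv _ (far-below i d 2 (s≤s (s≤s z≤n))))
                                   (below mv _ (far-below i d 3 (s≤s (s≤s (s≤s z≤n)))))
      go (r=i+3 i) mv pair wc =
        let L , R = reachable pair (trans (sym (below mv _ (s≤s (<-+ i 1)))) wc) in
        leftReachable-transport L (below mv _ (<-+ i 2)) (below mv _ (≤-<-trans pred[n]≤n (<-+ i 2))) ,
        rightReachable-before-move mv R
      go (r=i+2 i) mv pair wc =
        let L , R = reachable pair (trans (sym (below mv _ ≤-refl)) wc) in
        leftReachable-transport L (below mv _ (<-+ i 1)) (below mv _ (≤-<-trans pred[n]≤n (<-+ i 1))) ,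
        rightReachable-at-move mv R
      go (r=i+1 i) mv pair wc = ⊥-elim (separated-unordered pair (forward (complete (source mv))))
      go (r=i i)   mv pair wc with just-unique (second (target mv)) wc
      ... | refl with functional pair (forward (complete (source mv)))
      ... | refl = in-place (first (target mv)) , in-place (third (target mv))
      go (i=r+1 r) mv pair wc = ⊥-elim (separated-unordered (forward (complete (source mv))) pair)
      go (i=r+2 r) mv pair wc =
        let L , R = reachable pair (trans (sym (above mv _ ≤-refl)) wc) in
        leftReachable-at-move mv L ,
        rightReachable-transport R (above mv _ (m≤n+m _ 1)) (above mv _ (m≤n+m _ 2))
      go (i=r+3 r) mv pair wc =
        let L , R = reachable pair (trans (sym (above mv _ (m≤n+m _ 1))) wc) in
        leftReachable-after-move mv L ,
        rightReachable-transport R (above mv _ (m≤n+m _ 2)) (above mv _ (m≤n+m _ 3))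
      go (i≫r r d) mv pair wc =
        let L , R = reachable pair (trans (sym (above mv _ (far-above r d 2))) wc) in
        leftReachable-transport L (above mv _ (far-above r d 1)) (above mv _ (far-above r d 0)) ,
        rightReachable-transport R (above mv _ (far-above r d 3)) (above mv _ (far-above r d 4))

  module _ (tf : TriangleFree M) {v w : Word M} {H : History} (coh : Coherent v H)
           {r s t} (mv : MoveAt v w r s t) (red : IsReduced M w) where
    open Coherent coh

    private
      H′ : History
      H′ = H ∪ Shadow w

      edges′ : ∀ {i a b} → H′ i a b → Edge a b
      edges′ (inˡ h)  = edges h
      edges′ (inʳ sh) = Shadow.edge sh

    partner : ∀ {i a b y} → H i a b → w ‼ suc i ≡ just y → Σ (Fin n) λ e → Unordered H i y e
    partner {b = b} h wy with middle-preserved coh mv h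
    ... | inj₁ wa with just-unique wy wa
    ...   | refl = b , forward h
    partner {a = a} h wy | inj₂ wb with just-unique wy wb
    ...   | refl = a , backward h

    -- The one use of triangle-freeness: if e ≠ x, the pairs {y, e} recorded at i and {e, x}
    -- recorded at i - 2 close a triangle with the edge x–y.
    shadow-recorded : ∀ {i x y a b} → Shadow w i x y → H i a b → Unordered H i x y
    shadow-recorded {i} {x} {y} (shadow w₀ w₁ w₂ xy) h with partner h w₁
    ... | e , pair = from-reachable (reachable-preserved coh mv pair w₁)
      where
      from-reachable : LeftReachable w H′ i e × RightReachable w H′ i e → Unordered H i x y
      from-reachable (in-place wᵢ , _) with just-unique w₀ wᵢ
      ... | refl = Unordered-sym pair
      from-reachable (by-braid _ _ _ , in-place w₂′) with just-unique w₂ w₂′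
      ... | refl = Unordered-sym pair
      from-reachable (by-braid _ wx pair′ , by-braid _ _ _) with just-unique w₀ wx
      ... | refl = ⊥-elim (tf x y e (xy , Unordered-edge edges pair , Unordered-edge edges′ pair′))

    unordered-shadow-recorded : ∀ {i x y a b} → Unordered (Shadow w) i x y → Unordered H i a b → Unordered H i x y
    unordered-shadow-recorded (forward sh)  (forward h)  = shadow-recorded sh h
    unordered-shadow-recorded (forward sh)  (backward h) = shadow-recorded sh h
    unordered-shadow-recorded (backward sh) (forward h)  = Unordered-sym (shadow-recorded sh h)
    unordered-shadow-recorded (backward sh) (backward h) = Unordered-sym (shadow-recorded sh h)

    functional′ : ∀ {i a b c} → Unordered H′ i a b → Unordered H′ i a c → b ≡ c
    functional′ p q with Unordered-∪ p | Unordered-∪ q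
    ... | inj₁ p′ | inj₁ q′ = functional p′ q′
    ... | inj₁ p′ | inj₂ q′ = functional p′ (unordered-shadow-recorded q′ p′)
    ... | inj₂ p′ | inj₁ q′ = functional (unordered-shadow-recorded p′ q′) q′
    ... | inj₂ p′ | inj₂ q′ = Shadow-unordered-functional p′ q′

    reachable′ : ∀ {i c e} → Unordered H′ i c e → w ‼ suc i ≡ just c →
                 LeftReachable w H′ i e × RightReachable w H′ i e
    reachable′ p wc with Unordered-∪ p
    ... | inj₁ p′ = reachable-preserved coh mv p′ wc
    ... | inj₂ q′ = shadow-reachable q′ wc

    -- d is reachable at i, and pulling it there creates the factor d c d c.
    old-new-separated : ∀ {i a b c d} → H i a b → Shadow w (suc i) c d → ⊥
    old-new-separated {i} h (shadow w₁ w₂ w₃ cd) with partner h w₁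
    ... | e , pair with reachable-preserved coh mv pair w₁
    ... | _ , by-braid w₃′ _ _ with just-unique w₃ w₃′
    ...   | refl = Edge-irrefl (Unordered-edge edges pair)
    old-new-separated {i} h (shadow w₁ w₂ w₃ cd) | e , pair | L , in-place w₂′ with just-unique w₂ w₂′
    ...   | refl with pullLeft edges′ (λ p wc → proj₁ (reachable′ p wc)) i L
    ...     | u , w⇝u , uᵢ , agree =
      reduced-noABAB (reduced-braidEquiv red w⇝u)
        (shadow uᵢ (trans (agree _ ≤-refl) w₁) (trans (agree _ (n≤1+n _)) w₂) (Edge-sym cd))
        (trans (agree _ (m≤n+m _ 2)) w₃)

    -- b is reachable at i + 3, and pulling it there creates the factor a b a b.
    new-old-separated : ∀ {i a b c d} → Shadow w i a b → H (suc i) c d → ⊥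
    new-old-separated {i} (shadow w₀ w₁ w₂ ab) h with partner h w₂
    ... | e , pair with reachable-preserved coh mv pair w₂
    ... | by-braid w₀′ _ _ , _ with just-unique w₀ w₀′
    ...   | refl = Edge-irrefl (Unordered-edge edges pair)
    new-old-separated {i} (shadow w₀ w₁ w₂ ab) h | e , pair | in-place w₁′ , R with just-unique w₁ w₁′
    ...   | refl with pullRight edges′ (λ p wc → proj₂ (reachable′ p wc)) (suc i) R
    ...     | u , w⇝u , u₃ , agree =
      reduced-noABAB (reduced-braidEquiv red w⇝u)
        (shadow (trans (agree _ (m≤n+m _ 2)) w₀) (trans (agree _ (n≤1+n _)) w₁) (trans (agree _ ≤-refl) w₂) ab)
        u₃

    separated′ : ∀ {i a b c d} → H′ i a b → H′ (suc i) c d → ⊥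
    separated′ (inˡ h)  (inˡ h′)  = separated h h′
    separated′ (inˡ h)  (inʳ sh′) = old-new-separated h sh′
    separated′ (inʳ sh) (inˡ h′)  = new-old-separated sh h′
    separated′ (inʳ sh) (inʳ sh′) = reduced-shadows-separated red sh sh′

    middle′ : ∀ {i a b} → H′ i a b → w ‼ suc i ≡ just a ⊎ w ‼ suc i ≡ just b
    middle′ (inˡ h)  = middle-preserved coh mv h
    middle′ (inʳ sh) = inj₂ (Shadow.second sh)

    coherent-step : Coherent w H′
    coherent-step = record
      { edges      = edges′
      ; functional = functional′
      ; separated  = separated′
      ; middle     = middle′
      ; reachable  = reachable′
      ; complete   = inʳ }

  coherent-along : TriangleFree M → ∀ {v u H} → IsReduced M v → BraidEquiv M v u → Coherent v H →
                   Σ History λ H′ → Coherent u H′ × (∀ {i a b} → H i a b → H′ i a b)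
  coherent-along tf red ε coh = _ , coh , λ h → h
  coherent-along tf red (mv ◅ p) coh with braidMove⇒MoveAt mv
  ... | _ , _ , _ , mvAt with reduced-braidEquiv red (mv ◅ ε)
  ... | red′ with coherent-along tf red′ p (coherent-step tf coh mvAt red′)
  ... | H′ , coh′ , H⊆H′ = H′ , coh′ , λ h → H⊆H′ (inˡ h)

  braidEquiv-shadow-letters : TriangleFree M → ∀ {α β i s t s′ t′} → IsReduced M α → BraidEquiv M α β →
                              Shadow α i s t → Shadow β i s′ t′ → (s′ ≡ s × t′ ≡ t) ⊎ (s′ ≡ t × t′ ≡ s)
  braidEquiv-shadow-letters tf {β = β} {i} {s} {t} {s′} {t′} red α⇝β shα shβ
    with coherent-along tf red α⇝β (coherent-shadows red)
  ... | H , coh , Shadow⊆H = letters (middle (Shadow⊆H shα))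
    where
    open Coherent coh
    letters : β ‼ suc i ≡ just s ⊎ β ‼ suc i ≡ just t → (s′ ≡ s × t′ ≡ t) ⊎ (s′ ≡ t × t′ ≡ s)
    letters (inj₁ βs) with just-unique (Shadow.second shβ) βs
    ... | refl = inj₂ (sym (functional (forward (Shadow⊆H shα)) (backward (complete shβ))) , refl)
    letters (inj₂ βt) with just-unique (Shadow.second shβ) βt
    ... | refl = inj₁ (sym (functional (backward (Shadow⊆H shα)) (backward (complete shβ))) , refl)

  suppList-braidShadow : ∀ {α : Word M} i {a b rest} → drop i α ≡ a ∷ b ∷ a ∷ rest →
                         suppList M α i (i + 2) ≡ a ∷ b ∷ a ∷ []
  suppList-braidShadow i α≡ = cong₂ take (trans (cong (_∸ i) (sym (+-suc i 2))) (m+n∸m≡n i 3)) α≡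

  sameSupp-braidShadows : ∀ {α β : Word M} i {a b c d ra rb} →
                          drop i α ≡ a ∷ b ∷ a ∷ ra → drop i β ≡ c ∷ d ∷ c ∷ rb →
                          (∀ x → x ∈ a ∷ b ∷ a ∷ [] ⇔ x ∈ c ∷ d ∷ c ∷ []) → SameSupp M α β i (i + 2)
  sameSupp-braidShadows i α≡ β≡ same x =
    subst₂ (λ p q → x ∈ p ⇔ x ∈ q) (sym (suppList-braidShadow i α≡)) (sym (suppList-braidShadow i β≡))
           (same x)

proposition3p13 : ∀ {n} (M : CoxeterMatrix n) → SimplyLaced M → TriangleFree M →
    ∀ (α β : Word M) → IsReduced M α → IsReduced M β → _≈W_ M α β →
    length α ≥ 3 → BraidEquiv M α β →
    ∀ (i : ℕ) → IsBraidShadow M α i × IsBraidShadow M β i →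
    SameSupp M α β i (i + 2)
proposition3p13 M _ tf α β red _ _ _ α⇝β i (α-shadow , β-shadow)
  with isBraidShadow⇒Shadow M α i α-shadow | isBraidShadow⇒Shadow M β i β-shadow
... | s , t , shα , _ , α≡ | s′ , t′ , shβ , _ , β≡
  with braidEquiv-shadow-letters M tf red α⇝β shα shβ
... | inj₁ (refl , refl) = sameSupp-braidShadows M i α≡ β≡ (λ _ → mk⇔ id id)
... | inj₂ (refl , refl) = sameSupp-braidShadows M i α≡ β≡ (λ _ → mk⇔ ∈-aba⇒∈-bab ∈-aba⇒∈-bab)
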